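{- Let $\mathcal{C}$ be any class of complete Boolean algebras with operators. Then $\{A,B,C,D,E\}\models_{\mathcal{C}} F$, i.e. for every $\mathfrak{A}\in\mathcal{C}$, if $A,B,C,D,E$ are all valid in $\mathfrak{A}$ then $F:=\Box p\rightarrow\Box^2 p$ is valid in $\mathfrak{A}$.
   Context: A Boolean algebra with operators (BAO) is a structure $\langle A,\wedge,-,0,\Diamond\rangle$ where $\langle A,\wedge,-,0\rangle$ is a Boolean algebra and $\Diamond$ is a unary operation with $\Diamond 0=0$ and $\Diamond(a\vee b)=\Diamond a\vee\Diamond b$; $\Box a:=-\Diamond - a$. It is complete if the underlying Boolean algebra is complete. A modal formula is valid in a BAO if it evaluates to $1$ under every assignment of algebra elements to its variables. The formulas are: $A_i:=\Box (q_i\rightarrow r)$, $B_i:=\Box (r\rightarrow \Diamond q_i)$ for $i=1,2$, $C_1:=\Box \neg (q_1\wedge q_2)$, $A:= \big(r\wedge\Box p\wedge\neg \Box^2 p\wedge A_1\wedge A_2\wedge B_1\wedge B_2\wedge C_1\big)\rightarrow \Diamond\big(r\wedge\Box(r\rightarrow q_1\vee q_2)\big)$, $B:=\Box(p\rightarrow q)\rightarrow (\Box p\rightarrow \Box q)$, $C:=\Box p\rightarrow p$, $D:=(p\wedge \Diamond^2 q)\rightarrow (\Diamond q\vee \Diamond^2(q\wedge\Diamond p))$, $E:=(\Box p\wedge \neg \Box^2 p)\rightarrow \Diamond (\Box^2 p\wedge \neg\Box^3 p)$. -}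

module Defs where

open import Level using (Level; _⊔_; suc)
open import Data.Nat using (ℕ)
open import Data.Product using (Σ; _×_)
open import Relation.Unary using (Pred; _∈_)
open import Algebra.Lattice.Bundles using (BooleanAlgebra)

record BAO (c ℓ : Level) : Set (suc (c ⊔ ℓ)) where
  field
    boolAlg : BooleanAlgebra c ℓ
  open BooleanAlgebra boolAlg public
  field
    ◇       : Carrier → Carrier
    ◇-cong  : ∀ {a b} → a ≈ b → ◇ a ≈ ◇ b
    ◇-⊥     : ◇ ⊥ ≈ ⊥
    ◇-∨     : ∀ a b → ◇ (a ∨ b) ≈ (◇ a ∨ ◇ b)

  _≤_ : Carrier → Carrier → Set ℓ
  a ≤ b = (a ∧ b) ≈ a

  IsSup : ∀ {p} → Pred Carrier p → Carrier → Set (c ⊔ ℓ ⊔ p)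
  IsSup P s = (∀ x → x ∈ P → x ≤ s) × (∀ u → (∀ x → x ∈ P → x ≤ u) → s ≤ u)

  IsComplete : Set (suc (c ⊔ ℓ))
  IsComplete = (P : Pred Carrier (c ⊔ ℓ)) → Σ Carrier (IsSup P)

data Fm : Set where
  var  : ℕ → Fm
  ⊥ᶠ   : Fm
  ¬ᶠ_  : Fm → Fm
  _∧ᶠ_ : Fm → Fm → Fm
  ◇ᶠ_  : Fm → Fm

infixr 6 _∧ᶠ_
infixr 5 _∨ᶠ_
infixr 4 _⇒ᶠ_
infix 8 ¬ᶠ_ ◇ᶠ_ □ᶠ_

_∨ᶠ_ : Fm → Fm → Fm
φ ∨ᶠ ψ = ¬ᶠ (¬ᶠ φ ∧ᶠ ¬ᶠ ψ)

_⇒ᶠ_ : Fm → Fm → Fm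
φ ⇒ᶠ ψ = ¬ᶠ φ ∨ᶠ ψ

□ᶠ_ : Fm → Fm
□ᶠ φ = ¬ᶠ ◇ᶠ ¬ᶠ φ

module _ {c ℓ} (𝔄 : BAO c ℓ) where
  open BAO 𝔄

  ⟦_⟧ : Fm → (ℕ → Carrier) → Carrier
  ⟦ var n ⟧ v = v n
  ⟦ ⊥ᶠ ⟧ v = ⊥
  ⟦ ¬ᶠ φ ⟧ v = ¬ ⟦ φ ⟧ v
  ⟦ φ ∧ᶠ ψ ⟧ v = ⟦ φ ⟧ v ∧ ⟦ ψ ⟧ v
  ⟦ ◇ᶠ φ ⟧ v = ◇ (⟦ φ ⟧ v)

  Valid : Fm → Set (c ⊔ ℓ)
  Valid φ = ∀ (v : ℕ → Carrier) → ⟦ φ ⟧ v ≈ ⊤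

p q r q₁ q₂ : Fm
p = var 0
q = var 1
r = var 2
q₁ = var 3
q₂ = var 4

A₁ A₂ B₁ B₂ C₁ : Fm
A₁ = □ᶠ (q₁ ⇒ᶠ r)
A₂ = □ᶠ (q₂ ⇒ᶠ r)
B₁ = □ᶠ (r ⇒ᶠ ◇ᶠ q₁)
B₂ = □ᶠ (r ⇒ᶠ ◇ᶠ q₂)
C₁ = □ᶠ ¬ᶠ (q₁ ∧ᶠ q₂)

Aᶠ Bᶠ Cᶠ Dᶠ Eᶠ Fᶠ : Fm
Aᶠ = (r ∧ᶠ □ᶠ p ∧ᶠ ¬ᶠ □ᶠ □ᶠ p ∧ᶠ A₁ ∧ᶠ A₂ ∧ᶠ B₁ ∧ᶠ B₂ ∧ᶠ C₁)
       ⇒ᶠ ◇ᶠ (r ∧ᶠ □ᶠ (r ⇒ᶠ (q₁ ∨ᶠ q₂)))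
Bᶠ = □ᶠ (p ⇒ᶠ q) ⇒ᶠ (□ᶠ p ⇒ᶠ □ᶠ q)
Cᶠ = □ᶠ p ⇒ᶠ p
Dᶠ = (p ∧ᶠ ◇ᶠ ◇ᶠ q) ⇒ᶠ (◇ᶠ q ∨ᶠ ◇ᶠ ◇ᶠ (q ∧ᶠ ◇ᶠ p))
Eᶠ = (□ᶠ p ∧ᶠ ¬ᶠ □ᶠ □ᶠ p) ⇒ᶠ ◇ᶠ (□ᶠ □ᶠ p ∧ᶠ ¬ᶠ □ᶠ □ᶠ □ᶠ p)
Fᶠ = □ᶠ p ⇒ᶠ □ᶠ □ᶠ p

-- Fix x and let aₖ := □ᵏ⁺¹x ∧ ¬□ᵏ⁺²x be the layers of □-depth; F says a₀ = ⊥.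
-- By C the sequence □ᵏx decreases, so the layers are pairwise disjoint; by E each
-- layer sees the next one, and D turns these steps into aₖ ≤ ◇aₗ for all k ≤ l.
-- Completeness lets us join the layers into r, and those of index 1 and 2 mod 3
-- into q₁ and q₂. Then every point of r sees q₁, q₂ and a layer of index 0 mod 3
-- (in r but outside q₁ ∨ q₂), so the antecedent of A holds on a₀ while its
-- consequent fails everywhere in r; hence a₀ = ⊥.
module Submission where

open import Level using (Level; Lift; lift; _⊔_)
open import Data.Nat as ℕ using (ℕ; suc; _<_; _≤′_; _<′_; ≤′-refl; ≤′-step; s≤s; _+_; _*_; _%_; NonZero)
open import Data.Nat.Properties using (<-cmp; ≤⇒≤′; <⇒<′; <′⇒<; m≤n⇒m<n∨m≡n; m≤m*n; m≤n⇒m≤o+n)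
open import Data.Nat.DivMod using ([m+kn]%n≡m%n)
open import Data.Nat.GeneralisedArithmetic using (fold)
open import Data.Product using (∃; _,_; proj₁; proj₂)
open import Data.Sum using (inj₁; inj₂)
open import Relation.Binary.PropositionalEquality as ≡ using (_≢_; cong)
open import Relation.Binary.Definitions using (tri<; tri≈; tri>)
open import Relation.Nullary using (contradiction)
open import Algebra.Lattice.Bundles using (BooleanAlgebra)
import Algebra.Lattice.Properties.BooleanAlgebra as BooleanAlgebraProperties
import Relation.Binary.Lattice as OrderLattice
import Relation.Binary.Lattice.Properties.JoinSemilattice as JoinSemilatticeProperties
open import Relation.Binary.Bundles using (Poset)
import Relation.Binary.Reasoning.PartialOrder as ≤-Reasoning
import Relation.Binary.Reasoning.Setoid as ≈-Reasoning
open import Defs hiding (p; q; r; q₁; q₂)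

i+k*d≢j+l*d : ∀ {d} .{{_ : NonZero d}} i j k l → i % d ≢ j % d → i + k * d ≢ j + l * d
i+k*d≢j+l*d {d} i j k l i≢j eq =
  i≢j (≡.trans (≡.sym ([m+kn]%n≡m%n i k d)) (≡.trans (cong (_% d) eq) ([m+kn]%n≡m%n j l d)))

module BooleanAlgebraOrder {c ℓ} (B : BooleanAlgebra c ℓ) where
  open BooleanAlgebra B
  open BooleanAlgebraProperties B
    using (∨-∧-orderTheoreticLattice; deMorgan₁; ¬-involutive; ¬⊥≈⊤; ¬⊤≈⊥; ∧-identityʳ; ∧-zeroʳ; ∨-identityˡ)
  open BooleanAlgebraProperties B public using (poset)
  open OrderLattice.Lattice ∨-∧-orderTheoreticLattice public
    using (_≤_; x∧y≤x; x∧y≤y; ∧-greatest; x≤x∨y; joinSemilattice)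
  open JoinSemilatticeProperties joinSemilattice public using (x≤y⇒x∨y≈y)
  open Poset poset public
    using () renaming (refl to ≤-refl; trans to ≤-trans; reflexive to ≤-reflexive)
  open ≈-Reasoning setoid

  -- The shape ⟦ φ ⇒ᶠ ψ ⟧ evaluates to, so validity of an implication unfolds to x ⇛ y ≈ ⊤.
  infixr 5 _⇛_
  _⇛_ : Carrier → Carrier → Carrier
  x ⇛ y = ¬ (¬ (¬ x) ∧ ¬ y)

  ¬[¬x∧¬y]≈x∨y : ∀ {x y} → ¬ (¬ x ∧ ¬ y) ≈ x ∨ y
  ¬[¬x∧¬y]≈x∨y {x} {y} = begin
    ¬ (¬ x ∧ ¬ y)      ≈⟨ deMorgan₁ (¬ x) (¬ y) ⟩
    ¬ (¬ x) ∨ ¬ (¬ y)  ≈⟨ ∨-cong (¬-involutive x) (¬-involutive y) ⟩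
    x ∨ y              ∎

  ¬-⇛ : ∀ {x y} → ¬ (x ⇛ y) ≈ x ∧ ¬ y
  ¬-⇛ {x} {y} = trans (¬-involutive _) (∧-congʳ (¬-involutive x))

  ≈⊥⇒¬≈⊤ : ∀ {x} → x ≈ ⊥ → ¬ x ≈ ⊤
  ≈⊥⇒¬≈⊤ x≈⊥ = trans (¬-cong x≈⊥) ¬⊥≈⊤

  ¬≈⊥⇒≈⊤ : ∀ {x} → ¬ x ≈ ⊥ → x ≈ ⊤
  ¬≈⊥⇒≈⊤ ¬x≈⊥ = trans (sym (¬-involutive _)) (≈⊥⇒¬≈⊤ ¬x≈⊥)

  ≤⊥⇒≈⊥ : ∀ {x} → x ≤ ⊥ → x ≈ ⊥
  ≤⊥⇒≈⊥ {x} x≤⊥ = trans x≤⊥ (∧-zeroʳ x)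

  ≈⊤⇒≤ : ∀ {x y} → y ≈ ⊤ → x ≤ y
  ≈⊤⇒≤ {x} y≈⊤ = trans (sym (∧-identityʳ x)) (∧-congˡ (sym y≈⊤))

  ∧≈⊥⇒≤¬ : ∀ {x y} → x ∧ y ≈ ⊥ → x ≤ ¬ y
  ∧≈⊥⇒≤¬ {x} {y} x∧y≈⊥ = begin
    x                      ≈⟨ ∧-identityʳ x ⟨
    x ∧ ⊤                  ≈⟨ ∧-congˡ (∨-complementʳ y) ⟨
    x ∧ (y ∨ ¬ y)          ≈⟨ ∧-distribˡ-∨ x y (¬ y) ⟩
    (x ∧ y) ∨ (x ∧ ¬ y)    ≈⟨ ∨-congʳ x∧y≈⊥ ⟩
    ⊥ ∨ (x ∧ ¬ y)          ≈⟨ ∨-identityˡ _ ⟩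
    x ∧ ¬ y                ∎

  ≤¬⇒∧≈⊥ : ∀ {x y} → x ≤ ¬ y → x ∧ y ≈ ⊥
  ≤¬⇒∧≈⊥ {x} {y} x≤¬y = begin
    x ∧ y          ≈⟨ ∧-congʳ x≤¬y ⟩
    (x ∧ ¬ y) ∧ y  ≈⟨ ∧-assoc x (¬ y) y ⟩
    x ∧ (¬ y ∧ y)  ≈⟨ ∧-congˡ (∧-complementˡ y) ⟩
    x ∧ ⊥          ≈⟨ ∧-zeroʳ x ⟩
    ⊥              ∎

  ≤¬-sym : ∀ {x y} → x ≤ ¬ y → y ≤ ¬ x
  ≤¬-sym x≤¬y = ∧≈⊥⇒≤¬ (trans (∧-comm _ _) (≤¬⇒∧≈⊥ x≤¬y))

  ¬-antitone : ∀ {x y} → x ≤ y → ¬ y ≤ ¬ x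
  ¬-antitone {x} {y} x≤y = ≤¬-sym (≤-trans x≤y (≤-reflexive (sym (¬-involutive y))))

  ∧¬≈⊥⇒≤ : ∀ {x y} → x ∧ ¬ y ≈ ⊥ → x ≤ y
  ∧¬≈⊥⇒≤ {x} {y} x∧¬y≈⊥ = ≤-trans (∧≈⊥⇒≤¬ x∧¬y≈⊥) (≤-reflexive (¬-involutive y))

  ≤⇒∧¬≈⊥ : ∀ {x y} → x ≤ y → x ∧ ¬ y ≈ ⊥
  ≤⇒∧¬≈⊥ {x} {y} x≤y = ≤¬⇒∧≈⊥ (≤-trans x≤y (≤-reflexive (sym (¬-involutive y))))

  ⇛≈⊤⇒≤ : ∀ {x y} → x ⇛ y ≈ ⊤ → x ≤ y
  ⇛≈⊤⇒≤ x⇛y≈⊤ = ∧¬≈⊥⇒≤ (trans (sym ¬-⇛) (trans (¬-cong x⇛y≈⊤) ¬⊤≈⊥))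

  ≤⇒⇛≈⊤ : ∀ {x y} → x ≤ y → x ⇛ y ≈ ⊤
  ≤⇒⇛≈⊤ x≤y = ¬≈⊥⇒≈⊤ (trans ¬-⇛ (≤⇒∧¬≈⊥ x≤y))

module ModalAlgebra {c ℓ} (𝔄 : BAO c ℓ) where
  open BAO 𝔄 hiding (_≤_)
  open BooleanAlgebraProperties boolAlg using (¬-involutive; ¬⊤≈⊥; ∨-identityʳ)
  open BooleanAlgebraOrder boolAlg
  open ≤-Reasoning poset

  □ : Carrier → Carrier
  □ x = ¬ ◇ (¬ x)

  ◇-monotone : ∀ {x y} → x ≤ y → ◇ x ≤ ◇ y
  ◇-monotone {x} {y} x≤y = begin
    ◇ x          ≤⟨ x≤x∨y (◇ x) (◇ y) ⟩
    ◇ x ∨ ◇ y    ≈⟨ ◇-∨ x y ⟨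
    ◇ (x ∨ y)    ≈⟨ ◇-cong (x≤y⇒x∨y≈y x≤y) ⟩
    ◇ y          ∎

  ◇-≈⊥ : ∀ {x} → x ≈ ⊥ → ◇ x ≈ ⊥
  ◇-≈⊥ x≈⊥ = trans (◇-cong x≈⊥) ◇-⊥

  □-≈⊤ : ∀ {x} → x ≈ ⊤ → □ x ≈ ⊤
  □-≈⊤ x≈⊤ = ≈⊥⇒¬≈⊤ (◇-≈⊥ (trans (¬-cong x≈⊤) ¬⊤≈⊥))

  □⇛≈¬◇∧¬ : ∀ {x y} → □ (x ⇛ y) ≈ ¬ ◇ (x ∧ ¬ y)
  □⇛≈¬◇∧¬ = ¬-cong (◇-cong ¬-⇛)

  C⇒□-deflationary : Valid 𝔄 Cᶠ → ∀ x → □ x ≤ x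
  C⇒□-deflationary vC x = ⇛≈⊤⇒≤ (vC (λ _ → x))

  C⇒◇-inflationary : Valid 𝔄 Cᶠ → ∀ x → x ≤ ◇ x
  C⇒◇-inflationary vC x = begin
    x              ≈⟨ ¬-involutive x ⟨
    ¬ (¬ x)        ≤⟨ ¬-antitone (C⇒□-deflationary vC (¬ x)) ⟩
    ¬ □ (¬ x)      ≈⟨ ¬-involutive _ ⟩
    ◇ (¬ (¬ x))    ≈⟨ ◇-cong (¬-involutive x) ⟩
    ◇ x            ∎

  D⇒◇◇-shortcut : Valid 𝔄 Dᶠ → ∀ {x y} → y ∧ ◇ x ≈ ⊥ → x ≤ ◇ (◇ y) → x ≤ ◇ y
  D⇒◇◇-shortcut vD {x} {y} y∧◇x≈⊥ x≤◇◇y = begin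
    x                              ≤⟨ ∧-greatest ≤-refl x≤◇◇y ⟩
    x ∧ ◇ (◇ y)                    ≤⟨ ⇛≈⊤⇒≤ (vD (λ { 0 → x ; _ → y })) ⟩
    ¬ (¬ ◇ y ∧ ¬ ◇ (◇ (y ∧ ◇ x)))  ≈⟨ ¬[¬x∧¬y]≈x∨y ⟩
    ◇ y ∨ ◇ (◇ (y ∧ ◇ x))          ≈⟨ ∨-congˡ (◇-≈⊥ (◇-≈⊥ y∧◇x≈⊥)) ⟩
    ◇ y ∨ ⊥                        ≈⟨ ∨-identityʳ (◇ y) ⟩
    ◇ y                            ∎

  module Joins (complete : IsComplete) where
    ⋁ : {I : Set} → (I → Carrier) → Carrier
    ⋁ f = proj₁ (complete (λ y → Lift c (∃ λ i → y ≈ f i)))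

    ≤⋁ : ∀ {I} {f : I → Carrier} i → f i ≤ ⋁ f
    ≤⋁ {f = f} i = sym (proj₁ (proj₂ (complete _)) (f i) (lift (i , refl)))

    ⋁-least : ∀ {I} {f : I → Carrier} {u} → (∀ i → f i ≤ u) → ⋁ f ≤ u
    ⋁-least {f = f} {u} f≤u = sym (proj₂ (proj₂ (complete _)) u upper)
      where
      upper : ∀ y → Lift c (∃ λ i → y ≈ f i) → y ∧ u ≈ y
      upper y (lift (i , y≈fi)) = trans (∧-congʳ y≈fi) (trans (sym (f≤u i)) (sym y≈fi))

    ≤¬⋁ : ∀ {I} {f : I → Carrier} {x} → (∀ i → x ≤ ¬ f i) → x ≤ ¬ ⋁ f
    ≤¬⋁ x≤¬f = ≤¬-sym (⋁-least (λ i → ≤¬-sym (x≤¬f i)))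

  -- Assigned to the variables of the same name, these make the boxed conjuncts A₁ … C₁
  -- of A equal to ⊤, while r sees r-points outside q₁ ∨ q₂, refuting A's consequent on r.
  record Alternation : Set (c ⊔ ℓ) where
    field
      r q₁ q₂     : Carrier
      q₁≤r        : q₁ ≤ r
      q₂≤r        : q₂ ≤ r
      r≤◇q₁       : r ≤ ◇ q₁
      r≤◇q₂       : r ≤ ◇ q₂
      q₁∧q₂≈⊥     : q₁ ∧ q₂ ≈ ⊥
      r≤◇r∖q₁∨q₂  : r ≤ ◇ (r ∧ (¬ q₁ ∧ ¬ q₂))

  A-excludes : Valid 𝔄 Aᶠ → (W : Alternation) → ∀ {x y} →
               y ≤ Alternation.r W → y ≤ □ x ∧ ¬ □ (□ x) → y ≈ ⊥
  A-excludes vA W {x} {y} y≤r y≤□x∧¬□□x = ≤⊥⇒≈⊥ (begin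
    y                                      ≤⟨ y≤antecedent ⟩
    _                                      ≤⟨ ⇛≈⊤⇒≤ (vA v) ⟩
    ◇ (r ∧ □ (r ⇛ ¬ (¬ q₁ ∧ ¬ q₂)))        ≈⟨ ◇-≈⊥ r∧□[r⇛q₁∨q₂]≈⊥ ⟩
    ⊥                                      ∎)
    where
    open Alternation W

    v : ℕ → Carrier
    v = λ { 2 → r ; 3 → q₁ ; 4 → q₂ ; _ → x }

    y≤antecedent : y ≤ r ∧ □ x ∧ ¬ □ (□ x) ∧ □ (q₁ ⇛ r) ∧ □ (q₂ ⇛ r) ∧
                       □ (r ⇛ ◇ q₁) ∧ □ (r ⇛ ◇ q₂) ∧ □ (¬ (q₁ ∧ q₂))
    y≤antecedent =
      ∧-greatest y≤r (∧-greatest (≤-trans y≤□x∧¬□□x (x∧y≤x _ _))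
      (∧-greatest (≤-trans y≤□x∧¬□□x (x∧y≤y _ _))
      (∧-greatest (≈⊤⇒≤ (□-≈⊤ (≤⇒⇛≈⊤ q₁≤r)))
      (∧-greatest (≈⊤⇒≤ (□-≈⊤ (≤⇒⇛≈⊤ q₂≤r)))
      (∧-greatest (≈⊤⇒≤ (□-≈⊤ (≤⇒⇛≈⊤ r≤◇q₁)))
      (∧-greatest (≈⊤⇒≤ (□-≈⊤ (≤⇒⇛≈⊤ r≤◇q₂)))
                  (≈⊤⇒≤ (□-≈⊤ (≈⊥⇒¬≈⊤ q₁∧q₂≈⊥)))))))))

    r∧□[r⇛q₁∨q₂]≈⊥ : r ∧ □ (r ⇛ ¬ (¬ q₁ ∧ ¬ q₂)) ≈ ⊥
    r∧□[r⇛q₁∨q₂]≈⊥ = trans (∧-congˡ (trans □⇛≈¬◇∧¬ (¬-cong (◇-cong (∧-congˡ (¬-involutive _))))))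
                           (≤⇒∧¬≈⊥ r≤◇r∖q₁∨q₂)

  -- r joins the whole family and qᵢ its terms of index i mod 3; the terms of
  -- index 0 mod 3 are the r-points outside q₁ ∨ q₂.
  module ResidueAlternation (complete : IsComplete) (a : ℕ → Carrier)
    (disjoint : ∀ {m n} → m ≢ n → a m ≤ ¬ a n)
    (reach : ∀ {m n} → m ℕ.≤ n → a m ≤ ◇ (a n)) where
    open Joins complete

    class : ℕ → ℕ → Carrier
    class i k = a (i + k * 3)

    r≤◇⋁class : ∀ i → ⋁ a ≤ ◇ (⋁ (class i))
    r≤◇⋁class i = ⋁-least λ n → ≤-trans (reach (m≤n⇒m≤o+n i (m≤m*n n 3))) (◇-monotone (≤⋁ n))

    classes-disjoint : ∀ i j → i % 3 ≢ j % 3 → ∀ k → class i k ≤ ¬ ⋁ (class j)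
    classes-disjoint i j i≢j k = ≤¬⋁ λ l → disjoint (i+k*d≢j+l*d i j k l i≢j)

    alternation : Alternation
    alternation = record
      { r          = ⋁ a
      ; q₁         = ⋁ (class 1)
      ; q₂         = ⋁ (class 2)
      ; q₁≤r       = ⋁-least λ k → ≤⋁ (1 + k * 3)
      ; q₂≤r       = ⋁-least λ k → ≤⋁ (2 + k * 3)
      ; r≤◇q₁      = r≤◇⋁class 1
      ; r≤◇q₂      = r≤◇⋁class 2
      ; q₁∧q₂≈⊥    = ≤¬⇒∧≈⊥ (⋁-least (classes-disjoint 1 2 λ ()))
      ; r≤◇r∖q₁∨q₂ = ⋁-least λ n → ≤-trans (reach (m≤m*n n 3)) (◇-monotone
          (∧-greatest (≤⋁ (n * 3))
            (∧-greatest (classes-disjoint 0 1 (λ ()) n) (classes-disjoint 0 2 (λ ()) n))))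
      }

  module Layers (vC : Valid 𝔄 Cᶠ) (x : Carrier) where
    □^ : ℕ → Carrier
    □^ = fold x □

    layer : ℕ → Carrier
    layer k = □^ (suc k) ∧ ¬ □^ (suc (suc k))

    □^-antitone : ∀ {m n} → m ≤′ n → □^ n ≤ □^ m
    □^-antitone ≤′-refl = ≤-refl
    □^-antitone (≤′-step m≤′n) = ≤-trans (C⇒□-deflationary vC _) (□^-antitone m≤′n)

    layer<-disjoint : ∀ {m n} → m < n → layer m ≤ ¬ layer n
    layer<-disjoint {m} {n} m<n = begin
      layer m                 ≤⟨ x∧y≤y _ _ ⟩
      ¬ □^ (suc (suc m))      ≤⟨ ¬-antitone (≤-trans (x∧y≤x _ _) (□^-antitone (≤⇒≤′ (s≤s m<n)))) ⟩
      ¬ layer n               ∎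

    layer-disjoint : ∀ {m n} → m ≢ n → layer m ≤ ¬ layer n
    layer-disjoint {m} {n} m≢n with <-cmp m n
    ... | tri< m<n _ _ = layer<-disjoint m<n
    ... | tri≈ _ m≡n _ = contradiction m≡n m≢n
    ... | tri> _ _ n<m = ≤¬-sym (layer<-disjoint n<m)

    module _ (vD : Valid 𝔄 Dᶠ) (vE : Valid 𝔄 Eᶠ) where
      layer-step : ∀ k → layer k ≤ ◇ (layer (suc k))
      layer-step k = ⇛≈⊤⇒≤ (vE (λ _ → □^ k))

      -- D applies because layer (n + 1) lies in □ᵐ⁺³x, which sees no point of layer m.
      layer<-reach : ∀ {m n} → m <′ n → layer m ≤ ◇ (layer n)
      layer<-reach {m} ≤′-refl = layer-step m
      layer<-reach {m} {suc n} (≤′-step m<′n) =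
        D⇒◇◇-shortcut vD later∧◇layer≈⊥ (≤-trans (layer<-reach m<′n) (◇-monotone (layer-step n)))
        where
        later∧◇layer≈⊥ : layer (suc n) ∧ ◇ (layer m) ≈ ⊥
        later∧◇layer≈⊥ = ≤¬⇒∧≈⊥ (begin
          layer (suc n)             ≤⟨ x∧y≤x _ _ ⟩
          □^ (suc (suc n))          ≤⟨ □^-antitone (≤⇒≤′ (s≤s (s≤s (<′⇒< m<′n)))) ⟩
          ¬ ◇ (¬ □^ (suc (suc m)))  ≤⟨ ¬-antitone (◇-monotone (x∧y≤y _ _)) ⟩
          ¬ ◇ (layer m)             ∎)

      layer-reach : ∀ {m n} → m ℕ.≤ n → layer m ≤ ◇ (layer n)
      layer-reach m≤n with m≤n⇒m<n∨m≡n m≤n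
      ... | inj₁ m<n = layer<-reach (<⇒<′ m<n)
      ... | inj₂ ≡.refl = C⇒◇-inflationary vC _

-- B is the K axiom, valid in every BAO.
corollary2 : ∀ {c ℓ : Level} (𝔄 : BAO c ℓ) → BAO.IsComplete 𝔄 →
    Valid 𝔄 Aᶠ → Valid 𝔄 Bᶠ → Valid 𝔄 Cᶠ → Valid 𝔄 Dᶠ → Valid 𝔄 Eᶠ →
    Valid 𝔄 Fᶠ
corollary2 𝔄 complete vA _ vC vD vE v = ≤⇒⇛≈⊤ (∧¬≈⊥⇒≤ layer₀≈⊥)
  where
  open BAO 𝔄 using (boolAlg; _≈_; ⊥)
  open BooleanAlgebraOrder boolAlg using (≤-refl; ≤⇒⇛≈⊤; ∧¬≈⊥⇒≤)
  open ModalAlgebra 𝔄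
  open Layers vC (v 0)
  open Joins complete using (≤⋁)
  open ResidueAlternation complete layer layer-disjoint (layer-reach vD vE) using (alternation)

  layer₀≈⊥ : layer 0 ≈ ⊥
  layer₀≈⊥ = A-excludes vA alternation (≤⋁ 0) ≤-refl
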